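{- Let $\mathcal{S}$ be a blocking semioval in $PG(2,11)$ with $25$ points such that no line meets $\mathcal{S}$ in exactly $10$ points. Let $Q,R\in\mathcal{S}$ be distinct points such that each of $Q$ and $R$ lies on exactly three $6$-secants to $\mathcal{S}$ and the line $n=QR$ is a $6$-secant to $\mathcal{S}$. Let $\ell_1,\ell_2$ be the two $6$-secants through $Q$ other than $n$, and $m_1,m_2$ the two $6$-secants through $R$ other than $n$. Let $\mathcal{I}=\{\ell_i\cap m_j : i,j\in\{1,2\}\}$ (a set of four points). Then at least three points of $\mathcal{I}$ lie in $\mathcal{S}$.
   Context: $PG(2,11)$ is the Desarguesian projective plane over the field with 11 elements. A semioval is a set of points $S$ such that at each point of $S$ there is exactly one tangent line (a line meeting $S$ in exactly one point). A blocking set is a set of points $S$ such that every line meets $S$ in at least one point but $S$ contains no line. A blocking semioval is a set that is both a blocking set and a semioval. For an integer $k$, a $k$-secant to $\mathcal{S}$ is a line meeting $\mathcal{S}$ in exactly $k$ points. -}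

module Defs where

open import Data.Nat using (ℕ; zero; suc; _+_; _*_; _≡ᵇ_; _%_)
open import Data.Fin using (Fin; toℕ)
open import Data.Bool using (Bool; true; false; _∧_; _∨_; not; T; if_then_else_)
open import Data.Bool.Properties using (T?)
open import Data.List using (List; []; _∷_; length; filterᵇ; allFin; concatMap; map)
open import Data.Maybe using (Maybe; just; nothing)
open import Data.Product using (Σ; _,_; _×_; ∃)
open import Relation.Nullary using (¬_; yes; no)
open import Relation.Binary.PropositionalEquality using (_≡_)

-- The field GF(11) is ℤ/11ℤ; elements are represented by Fin 11 and
-- arithmetic is performed on toℕ values modulo 11.

q : ℕ
q = 11

F : Set
F = Fin q

isZero : ℕ → Bool
isZero n = n ≡ᵇ 0

isOne : ℕ → Bool
isOne n = n ≡ᵇ 1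

-- A triple (x, y, z) is normalized if its first nonzero coordinate is 1.
-- Normalized nonzero triples are canonical representatives of the
-- 1-dimensional subspaces of GF(11)^3, i.e. of the points of PG(2,11).
normalized : F → F → F → Bool
normalized x y z =
  isOne (toℕ x)
  ∨ (isZero (toℕ x) ∧ isOne (toℕ y))
  ∨ (isZero (toℕ x) ∧ isZero (toℕ y) ∧ isOne (toℕ z))

record Point : Set where
  constructor ⟨_,_,_⟩[_]
  field
    x y z : F
    norm  : T (normalized x y z)

-- Lines of PG(2,11): by duality also normalized triples [a : b : c],
-- the line being { (x:y:z) | a x + b y + c z = 0 }.
record Line : Set where
  constructor ⟦_,_,_⟧[_]
  field
    a b c : F
    norm  : T (normalized a b c)

incᵇ : Point → Line → Bool
incᵇ P ℓ = isZero ((toℕ (Point.x P) * toℕ (Line.a ℓ)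
                   + toℕ (Point.y P) * toℕ (Line.b ℓ)
                   + toℕ (Point.z P) * toℕ (Line.c ℓ)) % q)

_on_ : Point → Line → Set
P on ℓ = T (incᵇ P ℓ)

triples : List (F × F × F)
triples = concatMap (λ x → concatMap (λ y → map (λ z → (x , y , z)) (allFin q)) (allFin q)) (allFin q)

toPoint : F × F × F → Maybe Point
toPoint (x , y , z) with T? (normalized x y z)
... | yes p = just (⟨ x , y , z ⟩[ p ])
... | no _  = nothing

toLine : F × F × F → Maybe Line
toLine (x , y , z) with T? (normalized x y z)
... | yes p = just (⟦ x , y , z ⟧[ p ])
... | no _  = nothing

allPoints : List Point
allPoints = Data.List.mapMaybe toPoint triples

allLines : List Line
allLines = Data.List.mapMaybe toLine triples

PointSet : Set
PointSet = Point → Bool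

_∈S_ : Point → PointSet → Set
P ∈S S = T (S P)

size : PointSet → ℕ
size S = length (filterᵇ S allPoints)

meet : Line → PointSet → ℕ
meet ℓ S = length (filterᵇ (λ P → incᵇ P ℓ ∧ S P) allPoints)

Secant : ℕ → PointSet → Line → Set
Secant k S ℓ = meet ℓ S ≡ k

TangentAt : PointSet → Point → Line → Set
TangentAt S P ℓ = P on ℓ × Secant 1 S ℓ

Semioval : PointSet → Set
Semioval S = (P : Point) → P ∈S S →
  Σ Line (λ ℓ → TangentAt S P ℓ × ((ℓ' : Line) → TangentAt S P ℓ' → ℓ' ≡ ℓ))

BlockingSet : PointSet → Set
BlockingSet S =
  ((ℓ : Line) → Σ Point (λ P → P on ℓ × P ∈S S))
  × ((ℓ : Line) → Σ Point (λ P → P on ℓ × ¬ (P ∈S S)))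

BlockingSemioval : PointSet → Set
BlockingSemioval S = BlockingSet S × Semioval S

secantsThrough : ℕ → PointSet → Point → ℕ
secantsThrough k S P = length (filterᵇ (λ ℓ → incᵇ P ℓ ∧ (meet ℓ S ≡ᵇ k)) allLines)

inS : PointSet → Point → ℕ
inS S P = if S P then 1 else 0

-- Let ℓ ≠ m be 6-secants and suppose that X = ℓ ∩ m is not in S. The twelve lines through a
-- point Y ∉ S partition the 25 points of S, and each meets S, in at least two points unless
-- it is a tangent; hence Y lies on at least 4k − 1 tangents, k being the number of 6-secants
-- through Y. Summed over the six points of ℓ ∖ S, one of which is X with k ≥ 2, this gives
-- at least 5·3 + 7 = 22 pairs (Y, tangent through Y). The tangents of distinct pairs are
-- distinct and touch S off ℓ, and a semioval has only one tangent at each point, so there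
-- are at most |S ∖ ℓ| = 19 such pairs.
module Submission where

open import Defs
open import Data.Nat using (ℕ; _+_; _≤_)
open import Relation.Nullary using (¬_)
open import Relation.Binary.PropositionalEquality using (_≡_; _≢_)

open import Data.Bool using (Bool; true; false; T; not; _∧_; _∨_; if_then_else_)
open import Data.Bool.ListAction using (all)
open import Data.Bool.Properties using (T-≡; T-∧; T-∨; T?; T-irrelevant; ∧-comm)
open import Data.Empty using (⊥; ⊥-elim)
open import Data.Fin using () renaming (_≟_ to _≟ᶠ_)
open import Data.List using (List; []; _∷_; length; filterᵇ; mapMaybe; concatMap; map; allFin)
open import Data.List.Membership.Propositional using (_∈_; lose)
open import Data.List.Membership.Propositional.Properties using (∈-concatMap⁺; ∈-map⁺; ∈-allFin)
import Data.List.Relation.Unary.All as All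
open import Data.List.Relation.Unary.All.Properties using (all⁺)
import Data.List.Relation.Unary.Any as Any
open import Data.List.Relation.Unary.Any using (here; there)
import Data.List.Relation.Unary.Any.Properties as Any
open import Data.List.Relation.Unary.Unique.Propositional using (Unique; []; _∷_)
import Data.List.Relation.Unary.Unique.DecPropositional as UniqueDec
open import Data.Maybe using (Maybe; just)
import Data.Maybe.Relation.Unary.Any as MaybeAny
open import Data.Nat using (suc; _*_; _≡ᵇ_; z≤n; s≤s; _≤?_)
open import Data.Nat.Properties
open import Algebra.Properties.CommutativeSemigroup +-commutativeSemigroup
  using (interchange; xy∙z≈xz∙y)
open import Data.Product using (_×_; _,_; proj₁)
open import Data.Sum using (inj₁; inj₂)
open import Function.Base using (_∘_)
open import Function.Bundles using (Equivalence)
open import Relation.Binary.Definitions using (DecidableEquality)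
open import Relation.Binary.PropositionalEquality
  using (refl; sym; trans; cong; cong₂; subst; module ≡-Reasoning)
open import Relation.Nullary.Decidable using (yes; no; ⌊_⌋; toWitness; from-no; decidable-stable)

open Equivalence using (to; from)

-- Defined like inS, so that inS S P is definitionally 𝟙 (S P).
𝟙 : Bool → ℕ
𝟙 b = if b then 1 else 0

∑ : {A : Set} → List A → (A → ℕ) → ℕ
∑ []       f = 0
∑ (x ∷ xs) f = f x + ∑ xs f

infixr 6.5 ∑
syntax ∑ xs (λ x → e) = ∑[ x ∈ xs ] e

count : {A : Set} → (A → Bool) → List A → ℕ
count p xs = ∑[ x ∈ xs ] 𝟙 (p x)

T⇒𝟙≡1 : ∀ {b} → T b → 𝟙 b ≡ 1
T⇒𝟙≡1 {true} _ = refl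

¬T⇒𝟙≡0 : ∀ {b} → ¬ T b → 𝟙 b ≡ 0
¬T⇒𝟙≡0 {true}  ¬b = ⊥-elim (¬b _)
¬T⇒𝟙≡0 {false} _  = refl

T-not⇒¬T : ∀ {b} → T (not b) → ¬ T b
T-not⇒¬T {false} _ ()

¬T⇒T-not : ∀ {b} → ¬ T b → T (not b)
¬T⇒T-not {true}  ¬b = ¬b _
¬T⇒T-not {false} _  = _

𝟙-*-cong : ∀ b {m n} → (T b → m ≡ n) → 𝟙 b * m ≡ 𝟙 b * n
𝟙-*-cong true  m≡n = cong (1 *_) (m≡n _)
𝟙-*-cong false _   = refl

𝟙-*-mono-≤ : ∀ b {m n} → (T b → m ≤ n) → 𝟙 b * m ≤ 𝟙 b * n
𝟙-*-mono-≤ true  m≤n = +-monoˡ-≤ 0 (m≤n _)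
𝟙-*-mono-≤ false _   = z≤n

module _ {A : Set} where

  ∑-cong : {f g : A → ℕ} → (∀ x → f x ≡ g x) → ∀ xs → ∑ xs f ≡ ∑ xs g
  ∑-cong f≗g []       = refl
  ∑-cong f≗g (x ∷ xs) = cong₂ _+_ (f≗g x) (∑-cong f≗g xs)

  ∑-mono-≤ : {f g : A → ℕ} → (∀ x → f x ≤ g x) → ∀ xs → ∑ xs f ≤ ∑ xs g
  ∑-mono-≤ f≤g []       = z≤n
  ∑-mono-≤ f≤g (x ∷ xs) = +-mono-≤ (f≤g x) (∑-mono-≤ f≤g xs)

  ∑-mono-≤-at : {f g : A → ℕ} {x : A} {xs : List A} (k : ℕ) →
                (∀ y → f y ≤ g y) → x ∈ xs → f x + k ≤ g x → ∑ xs f + k ≤ ∑ xs g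
  ∑-mono-≤-at {f} {g} {xs = y ∷ ys} k f≤g (here refl) fy+k≤gy = begin
    f y + ∑ ys f + k ≡⟨ xy∙z≈xz∙y (f y) (∑ ys f) k ⟩
    f y + k + ∑ ys f ≤⟨ +-mono-≤ fy+k≤gy (∑-mono-≤ f≤g ys) ⟩
    g y + ∑ ys g     ∎
    where open ≤-Reasoning
  ∑-mono-≤-at {f} {g} {xs = y ∷ ys} k f≤g (there x∈ys) fx+k≤gx = begin
    f y + ∑ ys f + k   ≡⟨ +-assoc (f y) (∑ ys f) k ⟩
    f y + (∑ ys f + k) ≤⟨ +-mono-≤ (f≤g y) (∑-mono-≤-at k f≤g x∈ys fx+k≤gx) ⟩
    g y + ∑ ys g       ∎
    where open ≤-Reasoning

  ∑-zero : (xs : List A) → ∑[ _ ∈ xs ] 0 ≡ 0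
  ∑-zero []       = refl
  ∑-zero (_ ∷ xs) = ∑-zero xs

  ∑-distrib-+ : {f g : A → ℕ} → ∀ xs → ∑[ x ∈ xs ] (f x + g x) ≡ ∑ xs f + ∑ xs g
  ∑-distrib-+ []                 = refl
  ∑-distrib-+ {f} {g} (x ∷ xs) =
    trans (cong (f x + g x +_) (∑-distrib-+ xs)) (interchange (f x) (g x) _ _)

  *-distribˡ-∑ : (c : ℕ) (f : A → ℕ) → ∀ xs → c * ∑ xs f ≡ ∑[ x ∈ xs ] c * f x
  *-distribˡ-∑ c f []       = *-zeroʳ c
  *-distribˡ-∑ c f (x ∷ xs) =
    trans (*-distribˡ-+ c (f x) _) (cong (c * f x +_) (*-distribˡ-∑ c f xs))

  *-distribʳ-∑ : (c : ℕ) (f : A → ℕ) → ∀ xs → ∑ xs f * c ≡ ∑[ x ∈ xs ] f x * c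
  *-distribʳ-∑ c f []       = refl
  *-distribʳ-∑ c f (x ∷ xs) =
    trans (*-distribʳ-+ c (f x) _) (cong (f x * c +_) (*-distribʳ-∑ c f xs))

  count-cong : {p p′ : A → Bool} → (∀ x → p x ≡ p′ x) → ∀ xs → count p xs ≡ count p′ xs
  count-cong p≗p′ = ∑-cong (λ x → cong 𝟙 (p≗p′ x))

  length-filterᵇ : (p : A → Bool) → ∀ xs → length (filterᵇ p xs) ≡ count p xs
  length-filterᵇ p []       = refl
  length-filterᵇ p (x ∷ xs) with p x
  ... | true  = cong suc (length-filterᵇ p xs)
  ... | false = length-filterᵇ p xs

  count-filterᵇ : (p q : A → Bool) → ∀ xs → count q (filterᵇ p xs) ≡ count (λ x → p x ∧ q x) xs
  count-filterᵇ p q []       = refl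
  count-filterᵇ p q (x ∷ xs) with p x
  ... | true  = cong (𝟙 (q x) +_) (count-filterᵇ p q xs)
  ... | false = count-filterᵇ p q xs

  count-split : (p s : A → Bool) → ∀ xs →
                count (λ x → p x ∧ not (s x)) xs + count (λ x → p x ∧ s x) xs ≡ count p xs
  count-split p s xs = trans (sym (∑-distrib-+ xs)) (∑-cong (λ x → split (p x) (s x)) xs)
    where
    split : ∀ a b → 𝟙 (a ∧ not b) + 𝟙 (a ∧ b) ≡ 𝟙 a
    split false _     = refl
    split true  false = refl
    split true  true  = refl

  ∈⇒1≤count : ∀ {p : A → Bool} {x xs} → x ∈ xs → T (p x) → 1 ≤ count p xs
  ∈⇒1≤count (here refl)  px = ≤-trans (≤-reflexive (sym (T⇒𝟙≡1 px))) (m≤m+n _ _)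
  ∈⇒1≤count (there x∈xs) px = ≤-trans (∈⇒1≤count x∈xs px) (m≤n+m _ _)

  ∈⇒2≤count : ∀ {p : A → Bool} {x y xs} → x ∈ xs → y ∈ xs → x ≢ y → T (p x) → T (p y) →
              2 ≤ count p xs
  ∈⇒2≤count (here refl) (here refl) x≢y _ _ = ⊥-elim (x≢y refl)
  ∈⇒2≤count {p} {xs = _ ∷ xs} (here refl) (there y∈xs) _ px py =
    subst (λ k → 2 ≤ k + count p xs) (sym (T⇒𝟙≡1 px)) (s≤s (∈⇒1≤count y∈xs py))
  ∈⇒2≤count {p} {xs = _ ∷ xs} (there x∈xs) (here refl) _ px py =
    subst (λ k → 2 ≤ k + count p xs) (sym (T⇒𝟙≡1 py)) (s≤s (∈⇒1≤count x∈xs px))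
  ∈⇒2≤count {p} {xs = z ∷ _} (there x∈xs) (there y∈xs) x≢y px py =
    ≤-trans (∈⇒2≤count x∈xs y∈xs x≢y px py) (m≤n+m _ (𝟙 (p z)))

  count≡0 : ∀ {p : A → Bool} {xs} → All.All (λ x → ¬ T (p x)) xs → count p xs ≡ 0
  count≡0 All.[]           = refl
  count≡0 (¬px All.∷ ¬ps) = cong₂ _+_ (¬T⇒𝟙≡0 ¬px) (count≡0 ¬ps)

  count≤1 : ∀ {p : A → Bool} {xs} → Unique xs →
            (∀ {x y} → T (p x) → T (p y) → x ≢ y → ⊥) → count p xs ≤ 1
  count≤1 []                                _           = z≤n
  count≤1 {p} {x ∷ xs} (x≢xs ∷ unique-xs) at-most-one with T? (p x)
  ... | yes px = ≤-reflexive (cong₂ _+_ (T⇒𝟙≡1 px) (count≡0 (All.map ¬p x≢xs)))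
    where
    ¬p : ∀ {y} → x ≢ y → ¬ T (p y)
    ¬p x≢y py = at-most-one px py x≢y
  ... | no ¬px =
    subst (λ k → k + count p xs ≤ 1) (sym (¬T⇒𝟙≡0 ¬px)) (count≤1 unique-xs at-most-one)

∑-comm : {A B : Set} (h : A → B → ℕ) → ∀ xs ys →
         ∑[ x ∈ xs ] ∑[ y ∈ ys ] h x y ≡ ∑[ y ∈ ys ] ∑[ x ∈ xs ] h x y
∑-comm h []       ys = sym (∑-zero ys)
∑-comm h (x ∷ xs) ys =
  trans (cong (∑ ys (h x) +_) (∑-comm h xs ys)) (sym (∑-distrib-+ ys))

pencil-weight : ∀ a m → 1 ≤ m → 2 * 𝟙 a + 4 * 𝟙 (a ∧ (m ≡ᵇ 6)) ≤ 𝟙 a * m + 𝟙 (a ∧ (m ≡ᵇ 1))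
pencil-weight false _ _ = z≤n
pencil-weight true  1 _ = ≤-refl
pencil-weight true  2 _ = ≤-refl
pencil-weight true  3 _ = s≤s (s≤s z≤n)
pencil-weight true  4 _ = s≤s (s≤s z≤n)
pencil-weight true  5 _ = s≤s (s≤s z≤n)
pencil-weight true  6 _ = ≤-refl
pencil-weight true  (suc (suc (suc (suc (suc (suc (suc _))))))) _ = s≤s (s≤s z≤n)

record IsFiniteProjectivePlane {Pt Ln : Set} (inc : Pt → Ln → Bool)
                               (points : List Pt) (lines : List Ln) (n : ℕ) : Set where
  field
    ∈-points      : ∀ X → X ∈ points
    ∈-lines       : ∀ ℓ → ℓ ∈ lines
    points-unique : Unique points
    lines-unique  : Unique lines
    line-size     : ∀ ℓ → count (λ X → inc X ℓ) points ≡ suc n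
    pencil-size   : ∀ X → count (inc X) lines ≡ suc n
    join-count    : ∀ {X Y} → X ≢ Y → count (λ ℓ → inc X ℓ ∧ inc Y ℓ) lines ≡ 1

module FiniteProjectivePlane {Pt Ln : Set} {inc : Pt → Ln → Bool} {points : List Pt}
                             {lines : List Ln} {n : ℕ}
                             (plane : IsFiniteProjectivePlane inc points lines n) where

  open IsFiniteProjectivePlane plane public

  -- Doubly negated because no decidable equality of lines is assumed.
  join-unique : ∀ {X Y ℓ m} → X ≢ Y → T (inc X ℓ) → T (inc Y ℓ) → T (inc X m) → T (inc Y m) →
                ¬ ℓ ≢ m
  join-unique X≢Y Xℓ Yℓ Xm Ym ℓ≢m = <-irrefl (sym (join-count X≢Y))
    (∈⇒2≤count (∈-lines _) (∈-lines _) ℓ≢m (from T-∧ (Xℓ , Yℓ)) (from T-∧ (Xm , Ym)))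

  meet-count≤1 : ∀ {ℓ m} → ℓ ≢ m → count (λ X → inc X ℓ ∧ inc X m) points ≤ 1
  meet-count≤1 ℓ≢m = count≤1 points-unique λ Xℓm Yℓm X≢Y →
    let Xℓ , Xm = to T-∧ Xℓm; Yℓ , Ym = to T-∧ Yℓm in join-unique X≢Y Xℓ Yℓ Xm Ym ℓ≢m

  module PointSet (S : Pt → Bool) where

    ∣_∩S∣ : Ln → ℕ
    ∣ ℓ ∩S∣ = count (λ X → inc X ℓ ∧ S X) points

    ∣_∖S∣ : Ln → ℕ
    ∣ ℓ ∖S∣ = count (λ X → inc X ℓ ∧ not (S X)) points

    ∣S∖_∣ : Ln → ℕ
    ∣S∖ ℓ ∣ = count (λ X → S X ∧ not (inc X ℓ)) points

    ∣S∣ : ℕ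
    ∣S∣ = count S points

    secants : ℕ → Pt → ℕ
    secants k X = count (λ ℓ → inc X ℓ ∧ (∣ ℓ ∩S∣ ≡ᵇ k)) lines

    ∣∖S∣+∣∩S∣ : ∀ ℓ → ∣ ℓ ∖S∣ + ∣ ℓ ∩S∣ ≡ suc n
    ∣∖S∣+∣∩S∣ ℓ = trans (count-split (λ X → inc X ℓ) S points) (line-size ℓ)

    ∣S∖∣+∣∩S∣ : ∀ ℓ → ∣S∖ ℓ ∣ + ∣ ℓ ∩S∣ ≡ ∣S∣
    ∣S∖∣+∣∩S∣ ℓ = trans (cong (∣S∖ ℓ ∣ +_) (count-cong (λ X → ∧-comm (inc X ℓ) (S X)) points))
                        (count-split S (λ X → inc X ℓ) points)

    tangent-unique⇒secants-1≤1 :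
      (∀ {P L L′} → T (S P) → T (inc P L) → ∣ L ∩S∣ ≡ 1 → T (inc P L′) → ∣ L′ ∩S∣ ≡ 1 → L ≡ L′) →
      ∀ {P} → T (S P) → secants 1 P ≤ 1
    tangent-unique⇒secants-1≤1 tangent-unique P∈S =
      count≤1 lines-unique λ L-tangent L′-tangent L≢L′ →
      let PL , L-1 = to T-∧ L-tangent; PL′ , L′-1 = to T-∧ L′-tangent
      in L≢L′ (tangent-unique P∈S PL (≡ᵇ⇒≡ _ 1 L-1) PL′ (≡ᵇ⇒≡ _ 1 L′-1))

    pencil-partitions-S : ∀ {Y} → ¬ T (S Y) → ∑[ ℓ ∈ lines ] 𝟙 (inc Y ℓ) * ∣ ℓ ∩S∣ ≡ ∣S∣
    pencil-partitions-S {Y} Y∉S = begin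
      ∑[ ℓ ∈ lines ] 𝟙 (inc Y ℓ) * ∣ ℓ ∩S∣
        ≡⟨ ∑-cong (λ ℓ → *-distribˡ-∑ (𝟙 (inc Y ℓ)) _ points) lines ⟩
      ∑[ ℓ ∈ lines ] ∑[ X ∈ points ] 𝟙 (inc Y ℓ) * 𝟙 (inc X ℓ ∧ S X)
        ≡⟨ ∑-comm _ lines points ⟩
      ∑[ X ∈ points ] ∑[ ℓ ∈ lines ] 𝟙 (inc Y ℓ) * 𝟙 (inc X ℓ ∧ S X)
        ≡⟨ ∑-cong (λ X → ∑-cong (λ ℓ → 𝟙-reassoc (inc Y ℓ) (inc X ℓ) (S X)) lines) points ⟩
      ∑[ X ∈ points ] ∑[ ℓ ∈ lines ] 𝟙 (S X) * 𝟙 (inc Y ℓ ∧ inc X ℓ)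
        ≡⟨ ∑-cong (λ X → *-distribˡ-∑ (𝟙 (S X)) _ lines) points ⟨
      ∑[ X ∈ points ] 𝟙 (S X) * count (λ ℓ → inc Y ℓ ∧ inc X ℓ) lines
        ≡⟨ ∑-cong one-line-to-each points ⟩
      ∣S∣ ∎
      where
      open ≡-Reasoning
      𝟙-reassoc : ∀ a b s → 𝟙 a * 𝟙 (b ∧ s) ≡ 𝟙 s * 𝟙 (a ∧ b)
      𝟙-reassoc false _     false = refl
      𝟙-reassoc false _     true  = refl
      𝟙-reassoc true  false false = refl
      𝟙-reassoc true  false true  = refl
      𝟙-reassoc true  true  false = refl
      𝟙-reassoc true  true  true  = refl
      one-line-to-each : ∀ X → 𝟙 (S X) * count (λ ℓ → inc Y ℓ ∧ inc X ℓ) lines ≡ 𝟙 (S X)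
      one-line-to-each X =
        trans (𝟙-*-cong (S X) λ X∈S → join-count λ { refl → Y∉S X∈S }) (*-identityʳ (𝟙 (S X)))

    tangents-through-external-point : (∀ ℓ → 1 ≤ ∣ ℓ ∩S∣) → ∀ {Y} → ¬ T (S Y) →
                                      2 * suc n + 4 * secants 6 Y ≤ ∣S∣ + secants 1 Y
    tangents-through-external-point blocking {Y} Y∉S = begin
      2 * suc n + 4 * secants 6 Y
        ≡⟨ cong (λ k → 2 * k + 4 * secants 6 Y) (pencil-size Y) ⟨
      2 * count (inc Y) lines + 4 * secants 6 Y
        ≡⟨ cong₂ _+_ (*-distribˡ-∑ 2 _ lines) (*-distribˡ-∑ 4 _ lines) ⟩
      ∑[ ℓ ∈ lines ] 2 * 𝟙 (inc Y ℓ) + ∑[ ℓ ∈ lines ] 4 * 𝟙 (inc Y ℓ ∧ (∣ ℓ ∩S∣ ≡ᵇ 6))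
        ≡⟨ ∑-distrib-+ lines ⟨
      ∑[ ℓ ∈ lines ] (2 * 𝟙 (inc Y ℓ) + 4 * 𝟙 (inc Y ℓ ∧ (∣ ℓ ∩S∣ ≡ᵇ 6)))
        ≤⟨ ∑-mono-≤ (λ ℓ → pencil-weight (inc Y ℓ) ∣ ℓ ∩S∣ (blocking ℓ)) lines ⟩
      ∑[ ℓ ∈ lines ] (𝟙 (inc Y ℓ) * ∣ ℓ ∩S∣ + 𝟙 (inc Y ℓ ∧ (∣ ℓ ∩S∣ ≡ᵇ 1)))
        ≡⟨ ∑-distrib-+ lines ⟩
      ∑[ ℓ ∈ lines ] 𝟙 (inc Y ℓ) * ∣ ℓ ∩S∣ + secants 1 Y
        ≡⟨ cong (_+ secants 1 Y) (pencil-partitions-S Y∉S) ⟩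
      ∣S∣ + secants 1 Y ∎
      where open ≤-Reasoning

    crossing-count : ∀ {ℓ L} → L ≢ ℓ →
      ∣ L ∩S∣ + ∑[ X ∈ points ] 𝟙 (inc X ℓ ∧ not (S X)) * 𝟙 (inc X L)
        ≤ 1 + ∑[ X ∈ points ] 𝟙 (S X ∧ not (inc X ℓ)) * 𝟙 (inc X L)
    crossing-count {ℓ} {L} L≢ℓ = begin
      ∣ L ∩S∣ + ∑[ X ∈ points ] 𝟙 (inc X ℓ ∧ not (S X)) * 𝟙 (inc X L)
        ≡⟨ ∑-distrib-+ points ⟨
      ∑[ X ∈ points ] (𝟙 (inc X L ∧ S X) + 𝟙 (inc X ℓ ∧ not (S X)) * 𝟙 (inc X L))
        ≡⟨ ∑-cong (λ X → pointwise (inc X ℓ) (S X) (inc X L)) points ⟩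
      ∑[ X ∈ points ] (𝟙 (inc X L ∧ inc X ℓ) + 𝟙 (S X ∧ not (inc X ℓ)) * 𝟙 (inc X L))
        ≡⟨ ∑-distrib-+ points ⟩
      count (λ X → inc X L ∧ inc X ℓ) points + ∑[ X ∈ points ] 𝟙 (S X ∧ not (inc X ℓ)) * 𝟙 (inc X L)
        ≤⟨ +-monoˡ-≤ _ (meet-count≤1 L≢ℓ) ⟩
      1 + ∑[ X ∈ points ] 𝟙 (S X ∧ not (inc X ℓ)) * 𝟙 (inc X L) ∎
      where
      open ≤-Reasoning
      pointwise : ∀ x s l → 𝟙 (l ∧ s) + 𝟙 (x ∧ not s) * 𝟙 l ≡ 𝟙 (l ∧ x) + 𝟙 (s ∧ not x) * 𝟙 l
      pointwise false false false = refl
      pointwise false false true  = refl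
      pointwise false true  false = refl
      pointwise false true  true  = refl
      pointwise true  false false = refl
      pointwise true  false true  = refl
      pointwise true  true  false = refl
      pointwise true  true  true  = refl

    tangent-crossing-count : ∀ {ℓ L} → ∣ ℓ ∩S∣ ≢ 1 → ∣ L ∩S∣ ≡ 1 →
      ∑[ X ∈ points ] 𝟙 (inc X ℓ ∧ not (S X)) * 𝟙 (inc X L)
        ≤ ∑[ X ∈ points ] 𝟙 (S X ∧ not (inc X ℓ)) * 𝟙 (inc X L)
    tangent-crossing-count {ℓ} {L} ℓ-not-tangent L-tangent = +-cancelˡ-≤ 1 _ _
      (subst (λ k → k + on-ℓ∖S ≤ 1 + on-S∖ℓ) L-tangent
             (crossing-count λ { refl → ℓ-not-tangent L-tangent }))
      where
      on-ℓ∖S on-S∖ℓ : ℕ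
      on-ℓ∖S = ∑[ X ∈ points ] 𝟙 (inc X ℓ ∧ not (S X)) * 𝟙 (inc X L)
      on-S∖ℓ = ∑[ X ∈ points ] 𝟙 (S X ∧ not (inc X ℓ)) * 𝟙 (inc X L)

    weighted-tangent-crossing-count : ∀ {ℓ} → ∣ ℓ ∩S∣ ≢ 1 → ∀ L →
      ∑[ Y ∈ points ] 𝟙 (inc Y ℓ ∧ not (S Y)) * 𝟙 (inc Y L ∧ (∣ L ∩S∣ ≡ᵇ 1))
        ≤ ∑[ P ∈ points ] 𝟙 (S P ∧ not (inc P ℓ)) * 𝟙 (inc P L ∧ (∣ L ∩S∣ ≡ᵇ 1))
    weighted-tangent-crossing-count {ℓ} ℓ-not-tangent L = begin
      ∑[ Y ∈ points ] 𝟙 (inc Y ℓ ∧ not (S Y)) * 𝟙 (inc Y L ∧ tangent)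
        ≡⟨ ∑-cong (λ Y → factor (inc Y ℓ ∧ not (S Y)) (inc Y L) tangent) points ⟩
      ∑[ Y ∈ points ] 𝟙 tangent * (𝟙 (inc Y ℓ ∧ not (S Y)) * 𝟙 (inc Y L))
        ≡⟨ *-distribˡ-∑ (𝟙 tangent) _ points ⟨
      𝟙 tangent * (∑[ Y ∈ points ] 𝟙 (inc Y ℓ ∧ not (S Y)) * 𝟙 (inc Y L))
        ≤⟨ 𝟙-*-mono-≤ tangent (tangent-crossing-count ℓ-not-tangent ∘ ≡ᵇ⇒≡ _ 1) ⟩
      𝟙 tangent * (∑[ P ∈ points ] 𝟙 (S P ∧ not (inc P ℓ)) * 𝟙 (inc P L))
        ≡⟨ *-distribˡ-∑ (𝟙 tangent) _ points ⟩
      ∑[ P ∈ points ] 𝟙 tangent * (𝟙 (S P ∧ not (inc P ℓ)) * 𝟙 (inc P L))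
        ≡⟨ ∑-cong (λ P → factor (S P ∧ not (inc P ℓ)) (inc P L) tangent) points ⟨
      ∑[ P ∈ points ] 𝟙 (S P ∧ not (inc P ℓ)) * 𝟙 (inc P L ∧ tangent) ∎
      where
      open ≤-Reasoning
      tangent : Bool
      tangent = ∣ L ∩S∣ ≡ᵇ 1
      factor : ∀ a b t → 𝟙 a * 𝟙 (b ∧ t) ≡ 𝟙 t * (𝟙 a * 𝟙 b)
      factor false _     false = refl
      factor false _     true  = refl
      factor true  false false = refl
      factor true  false true  = refl
      factor true  true  false = refl
      factor true  true  true  = refl

    tangents-along-line : (∀ {P} → T (S P) → secants 1 P ≤ 1) → ∀ {ℓ} → ∣ ℓ ∩S∣ ≢ 1 →
      ∑[ Y ∈ points ] 𝟙 (inc Y ℓ ∧ not (S Y)) * secants 1 Y ≤ ∣S∖ ℓ ∣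
    tangents-along-line one-tangent {ℓ} ℓ-not-tangent = begin
      ∑[ Y ∈ points ] 𝟙 (inc Y ℓ ∧ not (S Y)) * secants 1 Y
        ≡⟨ ∑-cong (λ Y → *-distribˡ-∑ (𝟙 (inc Y ℓ ∧ not (S Y))) _ lines) points ⟩
      ∑[ Y ∈ points ] ∑[ L ∈ lines ] 𝟙 (inc Y ℓ ∧ not (S Y)) * 𝟙 (inc Y L ∧ (∣ L ∩S∣ ≡ᵇ 1))
        ≡⟨ ∑-comm _ points lines ⟩
      ∑[ L ∈ lines ] ∑[ Y ∈ points ] 𝟙 (inc Y ℓ ∧ not (S Y)) * 𝟙 (inc Y L ∧ (∣ L ∩S∣ ≡ᵇ 1))
        ≤⟨ ∑-mono-≤ (weighted-tangent-crossing-count ℓ-not-tangent) lines ⟩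
      ∑[ L ∈ lines ] ∑[ P ∈ points ] 𝟙 (S P ∧ not (inc P ℓ)) * 𝟙 (inc P L ∧ (∣ L ∩S∣ ≡ᵇ 1))
        ≡⟨ ∑-comm _ points lines ⟨
      ∑[ P ∈ points ] ∑[ L ∈ lines ] 𝟙 (S P ∧ not (inc P ℓ)) * 𝟙 (inc P L ∧ (∣ L ∩S∣ ≡ᵇ 1))
        ≡⟨ ∑-cong (λ P → *-distribˡ-∑ (𝟙 (S P ∧ not (inc P ℓ))) _ lines) points ⟨
      ∑[ P ∈ points ] 𝟙 (S P ∧ not (inc P ℓ)) * secants 1 P
        ≤⟨ ∑-mono-≤ (λ P → 𝟙-*-mono-≤ (S P ∧ not (inc P ℓ)) (one-tangent ∘ proj₁ ∘ to T-∧)) points ⟩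
      ∑[ P ∈ points ] 𝟙 (S P ∧ not (inc P ℓ)) * 1
        ≡⟨ ∑-cong (λ P → *-identityʳ _) points ⟩
      ∣S∖ ℓ ∣ ∎
      where open ≤-Reasoning

    six-secant-at : ∀ {Y ℓ} → T (inc Y ℓ) → ∣ ℓ ∩S∣ ≡ 6 → T (inc Y ℓ ∧ (∣ ℓ ∩S∣ ≡ᵇ 6))
    six-secant-at Yℓ ℓ-6 = from T-∧ (Yℓ , ≡⇒≡ᵇ _ 6 ℓ-6)

    tangents-through-point-on-6-secant : (∀ ℓ → 1 ≤ ∣ ℓ ∩S∣) → ∀ {ℓ Y} → ∣ ℓ ∩S∣ ≡ 6 →
      T (inc Y ℓ) → ¬ T (S Y) → 2 * suc n + 4 ≤ ∣S∣ + secants 1 Y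
    tangents-through-point-on-6-secant blocking {ℓ} ℓ-6 Yℓ Y∉S =
      ≤-trans (+-monoʳ-≤ (2 * suc n) (*-monoʳ-≤ 4 (∈⇒1≤count (∈-lines ℓ) (six-secant-at Yℓ ℓ-6))))
              (tangents-through-external-point blocking Y∉S)

    tangents-through-point-on-two-6-secants : (∀ ℓ → 1 ≤ ∣ ℓ ∩S∣) → ∀ {ℓ m X} → ℓ ≢ m →
      ∣ ℓ ∩S∣ ≡ 6 → ∣ m ∩S∣ ≡ 6 → T (inc X ℓ) → T (inc X m) → ¬ T (S X) →
      2 * suc n + 8 ≤ ∣S∣ + secants 1 X
    tangents-through-point-on-two-6-secants blocking {ℓ} {m} ℓ≢m ℓ-6 m-6 Xℓ Xm X∉S =
      ≤-trans (+-monoʳ-≤ (2 * suc n) (*-monoʳ-≤ 4 two-6-secants))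
              (tangents-through-external-point blocking X∉S)
      where
      two-6-secants : 2 ≤ secants 6 _
      two-6-secants =
        ∈⇒2≤count (∈-lines ℓ) (∈-lines m) ℓ≢m (six-secant-at Xℓ ℓ-6) (six-secant-at Xm m-6)

    external-meet-of-6-secants :
      (∀ ℓ → 1 ≤ ∣ ℓ ∩S∣) → (∀ {P} → T (S P) → secants 1 P ≤ 1) →
      ∀ {ℓ m X} → ℓ ≢ m → ∣ ℓ ∩S∣ ≡ 6 → ∣ m ∩S∣ ≡ 6 → T (inc X ℓ) → T (inc X m) → ¬ T (S X) →
      ∣ ℓ ∖S∣ * (2 * suc n + 4) + 4 ≤ ∣ ℓ ∖S∣ * ∣S∣ + ∣S∖ ℓ ∣
    external-meet-of-6-secants blocking one-tangent {ℓ} {m} {X} ℓ≢m ℓ-6 m-6 Xℓ Xm X∉S = begin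
      ∣ ℓ ∖S∣ * (2 * suc n + 4) + 4
        ≡⟨ cong (_+ 4) (*-distribʳ-∑ _ _ points) ⟩
      ∑[ Y ∈ points ] w Y * (2 * suc n + 4) + 4
        ≤⟨ ∑-mono-≤-at 4 on-ℓ∖S (∈-points X) at-X ⟩
      ∑[ Y ∈ points ] w Y * (∣S∣ + secants 1 Y)
        ≡⟨ ∑-cong (λ Y → *-distribˡ-+ (w Y) ∣S∣ _) points ⟩
      ∑[ Y ∈ points ] (w Y * ∣S∣ + w Y * secants 1 Y)
        ≡⟨ ∑-distrib-+ points ⟩
      ∑[ Y ∈ points ] w Y * ∣S∣ + ∑[ Y ∈ points ] w Y * secants 1 Y
        ≤⟨ +-mono-≤ (≤-reflexive (sym (*-distribʳ-∑ _ _ points)))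
                    (tangents-along-line one-tangent ℓ-not-tangent) ⟩
      ∣ ℓ ∖S∣ * ∣S∣ + ∣S∖ ℓ ∣ ∎
      where
      open ≤-Reasoning
      w : Pt → ℕ
      w Y = 𝟙 (inc Y ℓ ∧ not (S Y))
      ℓ-not-tangent : ∣ ℓ ∩S∣ ≢ 1
      ℓ-not-tangent ℓ-1 with () ← trans (sym ℓ-6) ℓ-1
      on-ℓ∖S : ∀ Y → w Y * (2 * suc n + 4) ≤ w Y * (∣S∣ + secants 1 Y)
      on-ℓ∖S Y = 𝟙-*-mono-≤ (inc Y ℓ ∧ not (S Y)) λ Y∈ℓ∖S →
        let Yℓ , Y∉S = to T-∧ Y∈ℓ∖S
        in tangents-through-point-on-6-secant blocking ℓ-6 Yℓ (T-not⇒¬T Y∉S)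
      w-X≡1 : w X ≡ 1
      w-X≡1 = T⇒𝟙≡1 (from T-∧ (Xℓ , ¬T⇒T-not X∉S))
      at-X : w X * (2 * suc n + 4) + 4 ≤ w X * (∣S∣ + secants 1 X)
      at-X = begin
        w X * (2 * suc n + 4) + 4 ≡⟨ cong (λ k → k * (2 * suc n + 4) + 4) w-X≡1 ⟩
        1 * (2 * suc n + 4) + 4   ≡⟨ cong (_+ 4) (*-identityˡ (2 * suc n + 4)) ⟩
        2 * suc n + 4 + 4         ≡⟨ +-assoc (2 * suc n) 4 4 ⟩
        2 * suc n + 8
          ≤⟨ tangents-through-point-on-two-6-secants blocking ℓ≢m ℓ-6 m-6 Xℓ Xm X∉S ⟩
        ∣S∣ + secants 1 X         ≡⟨ *-identityˡ (∣S∣ + secants 1 X) ⟨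
        1 * (∣S∣ + secants 1 X)   ≡⟨ cong (λ k → k * (∣S∣ + secants 1 X)) w-X≡1 ⟨
        w X * (∣S∣ + secants 1 X) ∎

_≟ᴾ_ : DecidableEquality Point
⟨ x , y , z ⟩[ p ] ≟ᴾ ⟨ x′ , y′ , z′ ⟩[ p′ ] with x ≟ᶠ x′ | y ≟ᶠ y′ | z ≟ᶠ z′
... | yes refl | yes refl | yes refl = yes (cong ⟨ x , y , z ⟩[_] (T-irrelevant p p′))
... | no x≢x′  | _        | _        = no λ { refl → x≢x′ refl }
... | yes _    | no y≢y′  | _        = no λ { refl → y≢y′ refl }
... | yes _    | yes _    | no z≢z′  = no λ { refl → z≢z′ refl }

_≟ᴸ_ : DecidableEquality Line
⟦ a , b , c ⟧[ p ] ≟ᴸ ⟦ a′ , b′ , c′ ⟧[ p′ ] with a ≟ᶠ a′ | b ≟ᶠ b′ | c ≟ᶠ c′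
... | yes refl | yes refl | yes refl = yes (cong ⟦ a , b , c ⟧[_] (T-irrelevant p p′))
... | no a≢a′  | _        | _        = no λ { refl → a≢a′ refl }
... | yes _    | no b≢b′  | _        = no λ { refl → b≢b′ refl }
... | yes _    | yes _    | no c≢c′  = no λ { refl → c≢c′ refl }

∈-triples : ∀ x y z → (x , y , z) ∈ triples
∈-triples x y z =
  ∈-concatMap⁺ (λ x → concatMap (λ y → map (x ,_) (pairs y)) (allFin q)) (lose (∈-allFin x)
    (∈-concatMap⁺ (λ y → map (x ,_) (pairs y)) (lose (∈-allFin y)
      (∈-map⁺ (x ,_) (∈-map⁺ (y ,_) (∈-allFin z))))))
  where
  pairs : F → List (F × F)
  pairs y = map (y ,_) (allFin q)

∈-mapMaybe⁺ : ∀ {A B : Set} {f : A → Maybe B} {a b xs} → f a ≡ just b → a ∈ xs → b ∈ mapMaybe f xs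
∈-mapMaybe⁺ {f = f} {b = b} {xs = xs} fa≡b a∈xs = Any.mapMaybe⁺ f xs (Any.map⁺ (Any.map
  (λ { refl → subst (MaybeAny.Any (b ≡_)) (sym fa≡b) (MaybeAny.just refl) }) a∈xs))

toPoint-coordinates : ∀ P → toPoint (Point.x P , Point.y P , Point.z P) ≡ just P
toPoint-coordinates ⟨ x , y , z ⟩[ p ] with T? (normalized x y z)
... | yes p′ = cong (just ∘ ⟨ x , y , z ⟩[_]) (T-irrelevant p′ p)
... | no ¬p  = ⊥-elim (¬p p)

toLine-coordinates : ∀ ℓ → toLine (Line.a ℓ , Line.b ℓ , Line.c ℓ) ≡ just ℓ
toLine-coordinates ⟦ a , b , c ⟧[ p ] with T? (normalized a b c)
... | yes p′ = cong (just ∘ ⟦ a , b , c ⟧[_]) (T-irrelevant p′ p)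
... | no ¬p  = ⊥-elim (¬p p)

∈-allPoints : ∀ P → P ∈ allPoints
∈-allPoints P = ∈-mapMaybe⁺ {f = toPoint} {xs = triples} (toPoint-coordinates P) (∈-triples _ _ _)

∈-allLines : ∀ ℓ → ℓ ∈ allLines
∈-allLines ℓ = ∈-mapMaybe⁺ {f = toLine} {xs = triples} (toLine-coordinates ℓ) (∈-triples _ _ _)

-- The lists of points and lines are arguments of these checks, rather than occurring in
-- them, so that evaluating a check enumerates each of them only once.

line-sizes-are : ℕ → List Point → List Line → Bool
line-sizes-are k ps ls = all (λ ℓ → count (λ X → incᵇ X ℓ) ps ≡ᵇ k) ls

pencil-sizes-are : ℕ → List Point → List Line → Bool
pencil-sizes-are k ps ls = all (λ X → count (incᵇ X) ls ≡ᵇ k) ps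

meets-pencil-once : List Point → Point → List Line → Bool
meets-pencil-once ps X pencil = all (λ Y → ⌊ X ≟ᴾ Y ⌋ ∨ (count (incᵇ Y) pencil ≡ᵇ 1)) ps

joins-are-unique : List Point → List Line → Bool
joins-are-unique ps ls = all (λ X → meets-pencil-once ps X (filterᵇ (incᵇ X) ls)) ps

all≡true⇒ : ∀ {A : Set} {p : A → Bool} {x xs} → all p xs ≡ true → x ∈ xs → T (p x)
all≡true⇒ {p = p} {xs = xs} all-p x∈xs = All.lookup (all⁺ p xs (from T-≡ all-p)) x∈xs

line-sizes-sound : ∀ k ps ls {ℓ} → line-sizes-are k ps ls ≡ true → ℓ ∈ ls →
                   count (λ X → incᵇ X ℓ) ps ≡ k
line-sizes-sound _ _ _ checked ℓ∈ls = ≡ᵇ⇒≡ _ _ (all≡true⇒ checked ℓ∈ls)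

pencil-sizes-sound : ∀ k ps ls {X} → pencil-sizes-are k ps ls ≡ true → X ∈ ps →
                     count (incᵇ X) ls ≡ k
pencil-sizes-sound _ _ _ checked X∈ps = ≡ᵇ⇒≡ _ _ (all≡true⇒ checked X∈ps)

joins-are-unique-sound : ∀ ps ls {X Y} → joins-are-unique ps ls ≡ true → X ∈ ps → Y ∈ ps → X ≢ Y →
                         count (λ ℓ → incᵇ X ℓ ∧ incᵇ Y ℓ) ls ≡ 1
joins-are-unique-sound ps ls {X} {Y} checked X∈ps Y∈ps X≢Y
  with to T-∨ (All.lookup (all⁺ _ ps (all≡true⇒ checked X∈ps)) Y∈ps)
... | inj₁ X≡Y      = ⊥-elim (X≢Y (toWitness X≡Y))
... | inj₂ one-line = trans (sym (count-filterᵇ (incᵇ X) (incᵇ Y) ls)) (≡ᵇ⇒≡ _ 1 one-line)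

PG[2,11] : IsFiniteProjectivePlane incᵇ allPoints allLines 11
PG[2,11] = record
  { ∈-points      = ∈-allPoints
  ; ∈-lines       = ∈-allLines
  ; points-unique = toWitness {a? = UniqueDec.unique? _≟ᴾ_ allPoints} _
  ; lines-unique  = toWitness {a? = UniqueDec.unique? _≟ᴸ_ allLines} _
  ; line-size     = λ ℓ → line-sizes-sound 12 allPoints allLines line-sizes (∈-allLines ℓ)
  ; pencil-size   = λ X → pencil-sizes-sound 12 allPoints allLines pencil-sizes (∈-allPoints X)
  ; join-count    = joins-are-unique-sound allPoints allLines joins (∈-allPoints _) (∈-allPoints _)
  }
  where
  line-sizes : line-sizes-are 12 allPoints allLines ≡ true
  line-sizes = refl
  pencil-sizes : pencil-sizes-are 12 allPoints allLines ≡ true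
  pencil-sizes = refl
  joins : joins-are-unique allPoints allLines ≡ true
  joins = refl

module PG[2,11] = FiniteProjectivePlane PG[2,11]

module _ (S : PointSet) where

  open PG[2,11].PointSet S

  meet≡∣∩S∣ : ∀ L → meet L S ≡ ∣ L ∩S∣
  meet≡∣∩S∣ L = length-filterᵇ (λ P → incᵇ P L ∧ S P) allPoints

  size≡∣S∣ : size S ≡ ∣S∣
  size≡∣S∣ = length-filterᵇ S allPoints

  blocking⇒meets : BlockingSet S → ∀ L → 1 ≤ ∣ L ∩S∣
  blocking⇒meets (meets , _) L = let P , PL , P∈S = meets L in
    ∈⇒1≤count {p = λ X → incᵇ X L ∧ S X} (∈-allPoints P) (from T-∧ (PL , P∈S))

  semioval⇒tangent-unique : Semioval S → ∀ {P L L′} → T (S P) →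
    T (incᵇ P L) → ∣ L ∩S∣ ≡ 1 → T (incᵇ P L′) → ∣ L′ ∩S∣ ≡ 1 → L ≡ L′
  semioval⇒tangent-unique semioval {P} {L} {L′} P∈S PL L-1 PL′ L′-1 =
    let _ , _ , unique = semioval P P∈S in
    trans (unique L (PL , trans (meet≡∣∩S∣ L) L-1))
          (sym (unique L′ (PL′ , trans (meet≡∣∩S∣ L′) L′-1)))

six-secants-meet-in-S : ∀ {S} → BlockingSemioval S → size S ≡ 25 →
  ∀ {ℓ m X} → ℓ ≢ m → Secant 6 S ℓ → Secant 6 S m → X on ℓ → X on m → X ∈S S
six-secants-meet-in-S {S} (blocking , semioval) size≡25 {ℓ} {m} {X} ℓ≢m ℓ-6 m-6 Xℓ Xm =
  decidable-stable (T? (S X)) λ X∉S → from-no (172 ≤? 169) (begin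
    172                            ≡⟨ cong (λ k → k * (2 * suc 11 + 4) + 4) ∣ℓ∖S∣≡6 ⟨
    ∣ ℓ ∖S∣ * (2 * suc 11 + 4) + 4
      ≤⟨ external-meet-of-6-secants (blocking⇒meets S blocking)
           (tangent-unique⇒secants-1≤1 (semioval⇒tangent-unique S semioval))
           ℓ≢m (∩S≡6 ℓ ℓ-6) (∩S≡6 m m-6) Xℓ Xm X∉S ⟩
    ∣ ℓ ∖S∣ * ∣S∣ + ∣S∖ ℓ ∣         ≡⟨ cong₂ _+_ (cong₂ _*_ ∣ℓ∖S∣≡6 ∣S∣≡25) ∣S∖ℓ∣≡19 ⟩
    169                            ∎)
  where
  open ≤-Reasoning
  open PG[2,11].PointSet S
  ∩S≡6 : ∀ L → Secant 6 S L → ∣ L ∩S∣ ≡ 6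
  ∩S≡6 L L-6 = trans (sym (meet≡∣∩S∣ S L)) L-6
  ∣S∣≡25 : ∣S∣ ≡ 25
  ∣S∣≡25 = trans (sym (size≡∣S∣ S)) size≡25
  ∣ℓ∖S∣≡6 : ∣ ℓ ∖S∣ ≡ 6
  ∣ℓ∖S∣≡6 = +-cancelʳ-≡ 6 _ _ (trans (cong (∣ ℓ ∖S∣ +_) (sym (∩S≡6 ℓ ℓ-6))) (∣∖S∣+∣∩S∣ ℓ))
  ∣S∖ℓ∣≡19 : ∣S∖ ℓ ∣ ≡ 19
  ∣S∖ℓ∣≡19 =
    +-cancelʳ-≡ 6 _ _ (trans (cong (∣S∖ ℓ ∣ +_) (sym (∩S≡6 ℓ ℓ-6))) (trans (∣S∖∣+∣∩S∣ ℓ) ∣S∣≡25))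

proposition3 : (S : PointSet) → BlockingSemioval S → size S ≡ 25
    → ((ℓ : Line) → ¬ Secant 10 S ℓ)
    → (Q R : Point) → Q ∈S S → R ∈S S → Q ≢ R
    → secantsThrough 6 S Q ≡ 3 → secantsThrough 6 S R ≡ 3
    → (n : Line) → Q on n → R on n → Secant 6 S n
    → (ℓ₁ ℓ₂ : Line) → Q on ℓ₁ → Q on ℓ₂ → Secant 6 S ℓ₁ → Secant 6 S ℓ₂
    → ℓ₁ ≢ n → ℓ₂ ≢ n → ℓ₁ ≢ ℓ₂
    → (m₁ m₂ : Line) → R on m₁ → R on m₂ → Secant 6 S m₁ → Secant 6 S m₂
    → m₁ ≢ n → m₂ ≢ n → m₁ ≢ m₂
    → (P₁₁ P₁₂ P₂₁ P₂₂ : Point)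
    → P₁₁ on ℓ₁ → P₁₁ on m₁ → P₁₂ on ℓ₁ → P₁₂ on m₂
    → P₂₁ on ℓ₂ → P₂₁ on m₁ → P₂₂ on ℓ₂ → P₂₂ on m₂
    → 3 ≤ inS S P₁₁ + inS S P₁₂ + inS S P₂₁ + inS S P₂₂
proposition3 S semioval size≡25 _ Q R _ _ Q≢R _ _ n Qn Rn _
             ℓ₁ ℓ₂ Qℓ₁ Qℓ₂ ℓ₁-6 ℓ₂-6 ℓ₁≢n ℓ₂≢n _ m₁ m₂ Rm₁ Rm₂ m₁-6 m₂-6 _ _ _
             P₁₁ P₁₂ P₂₁ P₂₂ P₁₁ℓ₁ P₁₁m₁ P₁₂ℓ₁ P₁₂m₂ P₂₁ℓ₂ P₂₁m₁ P₂₂ℓ₂ P₂₂m₂ =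
  subst (3 ≤_) (sym all-four-in-S) (n≤1+n 3)
  where
  in-S : ∀ ℓ m P → Q on ℓ → R on m → ℓ ≢ n → Secant 6 S ℓ → Secant 6 S m → P on ℓ → P on m →
         inS S P ≡ 1
  in-S ℓ m P Qℓ Rm ℓ≢n ℓ-6 m-6 Pℓ Pm =
    T⇒𝟙≡1 (six-secants-meet-in-S semioval size≡25 {X = P} ℓ≢m ℓ-6 m-6 Pℓ Pm)
    where
    ℓ≢m : ℓ ≢ m
    ℓ≢m refl = PG[2,11].join-unique Q≢R Qℓ Rm Qn Rn ℓ≢n
  all-four-in-S : inS S P₁₁ + inS S P₁₂ + inS S P₂₁ + inS S P₂₂ ≡ 4
  all-four-in-S = cong₂ _+_ (cong₂ _+_ (cong₂ _+_
    (in-S ℓ₁ m₁ P₁₁ Qℓ₁ Rm₁ ℓ₁≢n ℓ₁-6 m₁-6 P₁₁ℓ₁ P₁₁m₁)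
    (in-S ℓ₁ m₂ P₁₂ Qℓ₁ Rm₂ ℓ₁≢n ℓ₁-6 m₂-6 P₁₂ℓ₁ P₁₂m₂))
    (in-S ℓ₂ m₁ P₂₁ Qℓ₂ Rm₁ ℓ₂≢n ℓ₂-6 m₁-6 P₂₁ℓ₂ P₂₁m₁))
    (in-S ℓ₂ m₂ P₂₂ Qℓ₂ Rm₂ ℓ₂≢n ℓ₂-6 m₂-6 P₂₂ℓ₂ P₂₂m₂)
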